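{- Work in homotopy type theory with a univalent universe and higher inductive types. Fix a type $A$ and $n \geq -1$, and let $H$ be the higher inductive type with constructors \[ \eta : A \to H, \qquad \epsilon : \textstyle\prod_{a,b:A} \big(\|a = b\|_{n-1} \to \eta(a) = \eta(b)\big), \] \[ \delta : \textstyle\prod_{a:A} \big(\mathsf{refl}_{\eta(a)} = \epsilon(a,a,|\mathsf{refl}_a|)\big), \qquad t : H \text{ is an } (n+1)\text{ -type}. \] Then for every family $P : H \to \mathcal{U}$ of $n$-types, the map \[ \Big(\textstyle\prod_{x:H} P(x)\Big) \to \Big(\textstyle\prod_{a:A} P(\eta(a))\Big), \qquad g \mapsto g \circ \eta \] is an equivalence.
   Context: $\|X\|_{m}$ denotes $m$-truncation with projection $|{ - }|$ (for $m = -2$, $\|X\|_{ -2}$ is the unit type). $n$-types as usual (contractible for $n=-2$; $(n+1)$-type if all identity types are $n$-types). The equation in $\delta$ lives in the type $\eta(a) = \eta(a)$. $H$ comes with the standard induction principle for higher inductive types into families of $(n+1)$-types. -}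

{-# OPTIONS --without-K #-}
module Defs where

open import Level using (Level; _⊔_; suc)
open import Data.Product using (Σ; Σ-syntax; _,_; proj₁; proj₂)
open import Relation.Binary.PropositionalEquality using (_≡_; refl; subst)

data TLevel : Set where
  ⟨-2⟩ : TLevel
  S    : TLevel → TLevel

isContr : ∀ {ℓ} → Set ℓ → Set ℓ
isContr X = Σ X λ c → (x : X) → c ≡ x

is-level : ∀ {ℓ} → TLevel → Set ℓ → Set ℓ
is-level ⟨-2⟩  X = isContr X
is-level (S n) X = (x y : X) → is-level n (x ≡ y)

fiber : ∀ {ℓ ℓ'} {X : Set ℓ} {Y : Set ℓ'} → (X → Y) → Y → Set (ℓ ⊔ ℓ')
fiber {X = X} f y = Σ X λ x → f x ≡ y

isEquiv : ∀ {ℓ ℓ'} {X : Set ℓ} {Y : Set ℓ'} → (X → Y) → Set (ℓ ⊔ ℓ')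
isEquiv f = ∀ y → isContr (fiber f y)

_≃_ : ∀ {ℓ ℓ'} → Set ℓ → Set ℓ' → Set (ℓ ⊔ ℓ')
X ≃ Y = Σ (X → Y) isEquiv

idEquiv : ∀ {ℓ} (X : Set ℓ) → X ≃ X
idEquiv X = (λ x → x) , λ y → (y , refl) , λ { (x , refl) → refl }

idtoeqv : ∀ {ℓ} {X Y : Set ℓ} → X ≡ Y → X ≃ Y
idtoeqv {X = X} refl = idEquiv X

Univalence : (ℓ : Level) → Set (suc ℓ)
Univalence ℓ = (X Y : Set ℓ) → isEquiv (idtoeqv {ℓ} {X} {Y})

happly : ∀ {ℓ ℓ'} {X : Set ℓ} {Y : X → Set ℓ'} {f g : (x : X) → Y x} →
         f ≡ g → (x : X) → f x ≡ g x
happly refl x = refl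

FunExt : (ℓ ℓ' : Level) → Set (suc (ℓ ⊔ ℓ'))
FunExt ℓ ℓ' = {X : Set ℓ} {Y : X → Set ℓ'} (f g : (x : X) → Y x) → isEquiv (happly {f = f} {g = g})

record Truncation (ℓ : Level) (m : TLevel) : Set (suc ℓ) where
  field
    ‖_‖      : Set ℓ → Set ℓ
    ∣_∣      : {X : Set ℓ} → X → ‖ X ‖
    ‖‖-level : (X : Set ℓ) → is-level m ‖ X ‖
    ‖‖-ind   : {X : Set ℓ} (Q : ‖ X ‖ → Set ℓ) → ((u : ‖ X ‖) → is-level m (Q u)) →
               ((x : X) → Q ∣ x ∣) → (u : ‖ X ‖) → Q u
    ‖‖-β     : {X : Set ℓ} (Q : ‖ X ‖ → Set ℓ) (lv : (u : ‖ X ‖) → is-level m (Q u))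
               (d : (x : X) → Q ∣ x ∣) (x : X) → ‖‖-ind Q lv d ∣ x ∣ ≡ d x

-- The higher inductive type H of the lemma, for n = S m (so n ≥ -1, n-1 = m),
-- given a truncation operation ‖-‖_{n-1}.
record HIT-H {ℓ : Level} (m : TLevel) (T : Truncation ℓ m) (A : Set ℓ) : Set (suc ℓ) where
  open Truncation T
  field
    H : Set ℓ
    η : A → H
    ε : (a b : A) → ‖ a ≡ b ‖ → η a ≡ η b
    δ : (a : A) → refl {x = η a} ≡ ε a a ∣ refl ∣
    t : is-level (S (S m)) H
    ind : (Q : H → Set ℓ) → ((x : H) → is-level (S (S m)) (Q x)) →
          (fη : (a : A) → Q (η a)) →
          (fε : (a b : A) (q : ‖ a ≡ b ‖) → subst Q (ε a b q) (fη a) ≡ fη b) →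
          (fδ : (a : A) → subst (λ p → subst Q p (fη a) ≡ fη a) (δ a) refl ≡ fε a a ∣ refl ∣) →
          (x : H) → Q x
    ind-β : (Q : H → Set ℓ) (lv : (x : H) → is-level (S (S m)) (Q x))
            (fη : (a : A) → Q (η a))
            (fε : (a b : A) (q : ‖ a ≡ b ‖) → subst Q (ε a b q) (fη a) ≡ fη b)
            (fδ : (a : A) → subst (λ p → subst Q p (fη a) ≡ fη a) (δ a) refl ≡ fε a a ∣ refl ∣)
            (a : A) → ind Q lv fη fε fδ (η a) ≡ fη a

{-# OPTIONS --without-K #-}
module Submission where

-- A dependent function on η with values in a family P of n-types extends to H:
-- the path constructor ε has to be sent to paths in fibres of P, which are
-- (n-1)-types, so it is defined by induction on ‖ a ≡ b ‖ₙ₋₁ from its value at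
-- ∣ refl ∣; that value is dictated by δ, and then the δ-clause of the induction
-- is exactly the computation rule of the truncation. Two functions agreeing on η
-- agree everywhere, by extending along η into the family x ↦ g₁ x ≡ g₂ x, which
-- again consists of n-types. Existence and uniqueness of extensions make
-- precomposition with η an equivalence.

open import Defs
open import Level using (Level; suc)
open import Data.Product using (Σ; _,_; proj₁; proj₂)
open import Function.Bundles using (mk↔ₛ′)
open import Function.Properties.Inverse.HalfAdjointEquivalence using (↔⇒≃) renaming (_≃_ to _≃ₕ_)
open import Relation.Binary.PropositionalEquality
  using (_≡_; refl; sym; trans; cong; subst; trans-symˡ)

private
  variable
    ℓ : Level
    X Y : Set ℓ

fiber-≡-refl : (f : X → Y) {x′ x : X} (q : x′ ≡ x) →
               _≡_ {A = fiber f (f x)} (x′ , cong f q) (x , refl)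
fiber-≡-refl f refl = refl

≃ₕ⇒isEquiv : (e : X ≃ₕ Y) → isEquiv (_≃ₕ_.to e)
≃ₕ⇒isEquiv e y = (from y , right-inverse-of y) , λ { (x , refl) → centre-≡ x }
  where
  open _≃ₕ_ e
  centre-≡ : ∀ x → _≡_ {A = fiber to (to x)} (from (to x) , right-inverse-of (to x)) (x , refl)
  centre-≡ x = subst (λ r → (from (to x) , r) ≡ (x , refl))
                     (left-right x) (fiber-≡-refl to (left-inverse-of x))

inverse⇒isEquiv : (f : X → Y) (g : Y → X) →
                  (∀ y → f (g y) ≡ y) → (∀ x → g (f x) ≡ x) → isEquiv f
inverse⇒isEquiv f g f∘g g∘f = ≃ₕ⇒isEquiv (↔⇒≃ (mk↔ₛ′ f g f∘g g∘f))

contr⇒≡-contr : isContr X → (x y : X) → isContr (x ≡ y)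
contr⇒≡-contr (_ , k) x y = trans (sym (k x)) (k y) , λ { refl → trans-symˡ (k x) }

is-level-suc : ∀ n → is-level n X → is-level (S n) X
is-level-suc ⟨-2⟩  = contr⇒≡-contr
is-level-suc (S n) h x y = is-level-suc n (h x y)

funext : FunExt ℓ ℓ → {X : Set ℓ} {Y : X → Set ℓ} {f g : (x : X) → Y x} →
         (∀ x → f x ≡ g x) → f ≡ g
funext fe {f = f} {g} h = proj₁ (proj₁ (fe f g h))

Extension : {A H : Set ℓ} (η : A → H) (Q : H → Set ℓ) → ((a : A) → Q (η a)) → Set ℓ
Extension {A = A} {H} η Q f = Σ ((x : H) → Q x) λ g → (a : A) → g (η a) ≡ f a

HasExtensions : TLevel → {A H : Set ℓ} → (A → H) → Set (suc ℓ)
HasExtensions {ℓ} n {A} {H} η =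
  (Q : H → Set ℓ) → ((x : H) → is-level n (Q x)) → (f : (a : A) → Q (η a)) → Extension η Q f

extensions⇒precomp-isEquiv : FunExt ℓ ℓ → (n : TLevel) {A H : Set ℓ} (η : A → H) →
  HasExtensions n η → (P : H → Set ℓ) → ((x : H) → is-level n (P x)) →
  isEquiv (λ (g : (x : H) → P x) (a : A) → g (η a))
extensions⇒precomp-isEquiv fe n {A} {H} η extend P lvP =
  inverse⇒isEquiv restrict extension
    (λ f → funext fe (proj₂ (extend P lvP f)))
    (λ g → funext fe (proj₁ (extend (λ x → extension (restrict g) x ≡ g x)
                                    (λ x → is-level-suc n (lvP x) _ _)
                                    (proj₂ (extend P lvP (restrict g))))))
  where
  restrict : ((x : H) → P x) → (a : A) → P (η a)
  restrict g a = g (η a)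

  extension : ((a : A) → P (η a)) → (x : H) → P x
  extension f = proj₁ (extend P lvP f)

module _ {m : TLevel} (T : Truncation ℓ m) {A : Set ℓ} (HH : HIT-H m T A) where
  open Truncation T
  open HIT-H HH

  η-extensions : HasExtensions (S m) η
  η-extensions Q lvQ f = ind Q lv f fε fδ , ind-β Q lv f fε fδ
    where
    lv : (x : H) → is-level (S (S m)) (Q x)
    lv x = is-level-suc (S m) (lvQ x)

    Fε : (a b : A) → ‖ a ≡ b ‖ → Set ℓ
    Fε a b q = subst Q (ε a b q) (f a) ≡ f b

    fε-∣∣ : (a b : A) (p : a ≡ b) → Fε a b ∣ p ∣
    fε-∣∣ a .a refl = subst (λ p → subst Q p (f a) ≡ f a) (δ a) refl

    fε : (a b : A) (q : ‖ a ≡ b ‖) → Fε a b q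
    fε a b = ‖‖-ind (Fε a b) (λ _ → lvQ (η b) _ _) (fε-∣∣ a b)

    fδ : (a : A) → subst (λ p → subst Q p (f a) ≡ f a) (δ a) refl ≡ fε a a ∣ refl ∣
    fδ a = sym (‖‖-β (Fε a a) (λ _ → lvQ (η a) _ _) (fε-∣∣ a a) refl)

lemma8 : {ℓ : Level} → Univalence ℓ → FunExt ℓ ℓ →
         (m : TLevel) (T : Truncation ℓ m) (A : Set ℓ) (HH : HIT-H m T A) →
         (P : HIT-H.H HH → Set ℓ) → ((x : HIT-H.H HH) → is-level (S m) (P x)) →
         isEquiv (λ (g : (x : HIT-H.H HH) → P x) (a : A) → g (HIT-H.η HH a))
lemma8 _ fe m T A HH = extensions⇒precomp-isEquiv fe (S m) (HIT-H.η HH) (η-extensions T HH)
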